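{- For any positive integer $k$, $$\dim(F_k)=k \text{ and }\mathrm{edim}(F_k) = k + 2^k - 2.$$
   Context: For a positive integer $k$, $F_k$ is the graph on vertex set $A \cup B$, where $B = \{b_1, \ldots, b_k\}$ and $A = \{ a_S \mid S \subseteq B \}$; all pairs of distinct vertices of $B$ are adjacent, all pairs of distinct vertices of $A$ are adjacent, and $b_i\in B$, $a_S\in A$ are adjacent if and only if $b_i \in S$. Thus $|V(F_k)| = k + 2^k$. $\dim(G)$ is the (vertex) metric dimension: the minimum size of a set $S\subseteq V$ such that every pair of distinct vertices has different distance to some vertex of $S$. For an edge $e=xy$ and vertex $v$, $d(e,v)=\min\{d(x,v),d(y,v)\}$; $\mathrm{edim}(G)$ is the minimum size of a set $S\subseteq V$ such that every pair of distinct edges has different distance to some vertex of $S$. -}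

module Defs where

open import Level using (0ℓ)
open import Data.Nat using (ℕ; zero; suc; _≤_)
open import Data.Fin using (Fin)
open import Data.Fin.Subset using (Subset; _∈_)
open import Data.Sum using (_⊎_; inj₁; inj₂)
open import Data.Product using (_×_; _,_; ∃; ∃-syntax; Σ)
open import Data.List using (List; length)
open import Data.List.Relation.Unary.Unique.Propositional using (Unique)
import Data.List.Membership.Propositional as LM
open import Relation.Binary.PropositionalEquality using (_≡_; _≢_)
open import Relation.Nullary using (¬_)

record Graph : Set₁ where
  field
    V   : Set
    Adj : V → V → Set
open Graph public

data Walk (G : Graph) : V G → V G → ℕ → Set where
  nil  : ∀ {u} → Walk G u u 0
  cons : ∀ {u w v n} → Adj G u w → Walk G w v n → Walk G u v (suc n)

Dist : (G : Graph) → V G → V G → ℕ → Set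
Dist G u v d = Walk G u v d × (∀ m → Walk G u v m → d ≤ m)

-- Edges: ordered representatives (x , y) of an edge xy.
Edge : Graph → Set
Edge G = Σ (V G × V G) (λ { (x , y) → Adj G x y })

SameEdge : (G : Graph) → Edge G → Edge G → Set
SameEdge G ((x , y) , _) ((x' , y') , _) =
  (x ≡ x' × y ≡ y') ⊎ (x ≡ y' × y ≡ x')

EdgeDist : (G : Graph) → Edge G → V G → ℕ → Set
EdgeDist G ((x , y) , _) v d =
  ∃[ a ] ∃[ b ] (Dist G x v a × Dist G y v b × d ≡ Data.Nat._⊓_ a b)

Resolving : (G : Graph) → List (V G) → Set
Resolving G S = ∀ x y → x ≢ y →
  ∃[ s ] (s LM.∈ S × ∃[ a ] ∃[ b ] (Dist G x s a × Dist G y s b × a ≢ b))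

EdgeResolving : (G : Graph) → List (V G) → Set
EdgeResolving G S = ∀ e f → ¬ SameEdge G e f →
  ∃[ s ] (s LM.∈ S × ∃[ a ] ∃[ b ] (EdgeDist G e s a × EdgeDist G f s b × a ≢ b))

IsMinSize : {A : Set} → (List A → Set) → ℕ → Set
IsMinSize P m =
  (∃[ S ] (Unique S × P S × length S ≡ m)) ×
  (∀ S → Unique S → P S → m ≤ length S)

MetricDim : Graph → ℕ → Set
MetricDim G = IsMinSize {V G} (Resolving G)

EdgeMetricDim : Graph → ℕ → Set
EdgeMetricDim G = IsMinSize {V G} (EdgeResolving G)

-- The graph F_k: B = Fin k (b_i), A = Subset k (a_S).
FAdj : (k : ℕ) → (Fin k ⊎ Subset k) → (Fin k ⊎ Subset k) → Set
FAdj k (inj₁ i) (inj₁ j) = i ≢ j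
FAdj k (inj₂ S) (inj₂ T) = S ≢ T
FAdj k (inj₁ i) (inj₂ S) = i ∈ S
FAdj k (inj₂ S) (inj₁ i) = i ∈ S

F : ℕ → Graph
F k = record { V = Fin k ⊎ Subset k ; Adj = FAdj k }

-- The vertex a_B is adjacent to every other vertex, so all distances in F_k are 0, 1 or 2,
-- and relative to a set S a vertex outside S is described by which elements of S are its
-- neighbours. A resolving set S therefore encodes the k + 2^k vertices injectively into
-- S ⊎ 2^S, so k + 2^k ≤ |S| + 2^|S| and |S| ≥ k; and B resolves, as b_i sees a_T at
-- distance 1 or 2 according as i ∈ T or not.
-- The spokes a_B x and a_B y are at the same distance d(a_B, s) from every s ≠ x, y, so an
-- edge resolving set contains all vertices but a_B and at most one other. Conversely all
-- vertices except a_∅ and a_B resolve the edges: an endpoint of one edge that is not an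
-- endpoint of the other sees them at distance 0 and ≥ 1, and when a_∅ and a_B are the only
-- such endpoints the edges are a_T a_∅ and a_T a_B, seen at distances 2 and 1 from b_i, i ∉ T.

module Submission where

open import Defs
open import Data.Nat using (ℕ; _≤_; _+_; _∸_; _^_)
open import Data.Product using (_×_)

open import Data.Nat using (zero; suc; z≤n; s≤s; _<_; _⊓_)
open import Data.Nat.Properties
  using (module ≤-Reasoning; ≤-antisym; ≤-trans; n≤1+n; <⇒≢; <⇒≱; <⇒≤; ≮⇒≥; n≢0⇒n>0;
         +-comm; +-identityʳ; +-mono-<-≤; ^-monoʳ-≤; ⊓-comm; ⊓-zeroʳ; ⊓-glb; m≤n⇒m⊓n≡m;
         m≤n+o⇒m∸n≤o; m+n≤o⇒m≤o∸n)
open import Data.Product using (_,_; proj₁; proj₂; ∃-syntax)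
open import Data.Sum using (_⊎_; inj₁; inj₂)
open import Data.Sum.Properties using (inj₁-injective; inj₂-injective)
import Data.Sum.Properties as Sum
open import Data.Bool using (Bool; true; false; if_then_else_)
import Data.Bool.Properties as Bool
open import Data.Fin using (Fin)
import Data.Fin.Properties as Fin
open import Data.Fin.Subset using (Subset; ⊤; inside; outside)
  renaming (⊥ to ∅; _∈_ to _∈ₛ_; _∉_ to _∉ₛ_; _⊆_ to _⊆ₛ_)
open import Data.Fin.Subset.Properties using (∈⊤; ∉⊥; ⊆⊤; ⊆-antisym; _⊆?_)
  renaming (_∈?_ to _∈ₛ?_)
open import Data.Vec using ([]; _∷_; tabulate) renaming (lookup to lookupᵥ)
open import Data.Vec.Properties using (lookup∘tabulate)
import Data.Vec.Properties as Vec
open import Data.List using (List; []; _∷_; [_]; map; _++_; length; lookup; allFin; filter)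
open import Data.List.Properties using (length-map; length-++; length-tabulate)
open import Data.List.Relation.Unary.Any as Any using (here; there; any?)
open import Data.List.Relation.Unary.Any.Properties using (lookup-index)
import Data.List.Relation.Unary.All as All
open import Data.List.Relation.Unary.AllPairs using ([]; _∷_)
open import Data.List.Relation.Unary.Unique.Propositional using (Unique)
import Data.List.Relation.Unary.Unique.Propositional.Properties as Unique
open import Data.List.Relation.Binary.Subset.Propositional using (_⊆_)
open import Data.List.Membership.Propositional using (_∈_; _∉_; find; lose)
open import Data.List.Membership.Propositional.Properties
  using (∈-map⁺; ∈-map⁻; ∈-++⁺ˡ; ∈-++⁺ʳ; ∈-allFin; ∈-filter⁺; ∈-filter⁻; ∈-lookup)
import Data.List.Membership.DecPropositional as DecMembership
open import Relation.Binary.PropositionalEquality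
  using (_≡_; _≢_; refl; sym; trans; cong; cong₂; subst; subst₂; module ≡-Reasoning)
open import Relation.Binary.Definitions using (DecidableEquality; Decidable; Symmetric; Irreflexive)
open import Relation.Nullary using (¬_; Dec; yes; no; does; ¬?; contradiction; _×-dec_)
open import Relation.Nullary.Decidable using (dec-true; dec-false; decidable-stable)
open import Function using (_∘_; case_of_)
open import Function.Definitions using (Injective)

module _ {A : Set} where

  lookup-injective : ∀ {xs : List A} → Unique xs → ∀ {i j} → lookup xs i ≡ lookup xs j → i ≡ j
  lookup-injective (_ ∷ _)     {Fin.zero}  {Fin.zero}  _  = refl
  lookup-injective (x∉xs ∷ _)  {Fin.zero}  {Fin.suc j} eq = contradiction eq (All.lookup x∉xs (∈-lookup j))
  lookup-injective (x∉xs ∷ _)  {Fin.suc i} {Fin.zero}  eq = contradiction (sym eq) (All.lookup x∉xs (∈-lookup i))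
  lookup-injective (_ ∷ xs!)   {Fin.suc i} {Fin.suc j} eq = cong Fin.suc (lookup-injective xs! eq)

  Unique-⊆⇒length≤ : ∀ {xs ys : List A} → Unique xs → xs ⊆ ys → length xs ≤ length ys
  Unique-⊆⇒length≤ {xs} {ys} xs! xs⊆ys = Fin.injective⇒≤ position-injective
    where
    position : Fin (length xs) → Fin (length ys)
    position i = Any.index (xs⊆ys (∈-lookup i))

    position-injective : ∀ {i j} → position i ≡ position j → i ≡ j
    position-injective {i} {j} eq = lookup-injective xs! (begin
      lookup xs i                ≡⟨ lookup-index (xs⊆ys (∈-lookup i)) ⟩
      lookup ys (position i)     ≡⟨ cong (lookup ys) eq ⟩
      lookup ys (position j)     ≡⟨ sym (lookup-index (xs⊆ys (∈-lookup j))) ⟩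
      lookup xs j                ∎)
      where open ≡-Reasoning

  ∉⇒≢ : ∀ {x y} {xs : List A} → x ∉ xs → y ∈ xs → x ≢ y
  ∉⇒≢ x∉xs y∈xs refl = x∉xs y∈xs

  module _ (_≟_ : DecidableEquality A) where
    open DecMembership _≟_ using (_∈?_)

    one-outside⇒length≤ : ∀ {xs ys : List A} → Unique xs →
      (∀ {x y} → x ∈ xs → y ∈ xs → x ∉ ys → y ∉ ys → x ≡ y) →
      length xs ≤ suc (length ys)
    one-outside⇒length≤ {xs} {ys} xs! at-most-one with any? (¬? ∘ (_∈? ys)) xs
    ... | yes some-outside =
      let a , a∈xs , a∉ys = find some-outside
      in Unique-⊆⇒length≤ xs! λ {z} z∈xs → case z ∈? ys of λ where
           (yes z∈ys) → there z∈ys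
           (no z∉ys)  → here (at-most-one z∈xs a∈xs z∉ys a∉ys)
    ... | no none-outside =
      ≤-trans (Unique-⊆⇒length≤ xs! λ {z} z∈xs →
                 decidable-stable (z ∈? ys) (none-outside ∘ lose z∈xs))
              (n≤1+n _)

module _ {A B C : Set} (f : A → C) (g : B → C) where

  mapJoin : List A → List B → List C
  mapJoin xs ys = map f xs ++ map g ys

  mapJoin⁺ : Injective _≡_ _≡_ f → Injective _≡_ _≡_ g → (∀ {x y} → f x ≢ g y) →
             ∀ {xs ys} → Unique xs → Unique ys → Unique (mapJoin xs ys)
  mapJoin⁺ f-injective g-injective f≢g {xs} {ys} xs! ys! =
    Unique.++⁺ (Unique.map⁺ f-injective xs!) (Unique.map⁺ g-injective ys!) disjoint
    where
    disjoint : ∀ {z} → ¬ (z ∈ map f xs × z ∈ map g ys)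
    disjoint (z∈fxs , z∈gys) with ∈-map⁻ f z∈fxs | ∈-map⁻ g z∈gys
    ... | _ , _ , refl | _ , _ , fx≡gy = f≢g fx≡gy

  ∈-mapJoinˡ : ∀ {x xs} ys → x ∈ xs → f x ∈ mapJoin xs ys
  ∈-mapJoinˡ _ x∈xs = ∈-++⁺ˡ (∈-map⁺ f x∈xs)

  ∈-mapJoinʳ : ∀ xs {y ys} → y ∈ ys → g y ∈ mapJoin xs ys
  ∈-mapJoinʳ xs y∈ys = ∈-++⁺ʳ (map f xs) (∈-map⁺ g y∈ys)

  length-mapJoin : ∀ xs ys → length (mapJoin xs ys) ≡ length xs + length ys
  length-mapJoin xs ys = begin
    length (map f xs ++ map g ys)         ≡⟨ length-++ (map f xs) ⟩
    length (map f xs) + length (map g ys) ≡⟨ cong₂ _+_ (length-map f xs) (length-map g ys) ⟩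
    length xs + length ys                 ∎
    where open ≡-Reasoning

subsets : ∀ n → List (Subset n)
subsets zero    = [ [] ]
subsets (suc n) = mapJoin (inside ∷_) (outside ∷_) (subsets n) (subsets n)

∈-subsets : ∀ {n} (p : Subset n) → p ∈ subsets n
∈-subsets []            = here refl
∈-subsets (inside ∷ p)  = ∈-mapJoinˡ (inside ∷_) (outside ∷_) _ (∈-subsets p)
∈-subsets (outside ∷ p) = ∈-mapJoinʳ (inside ∷_) (outside ∷_) _ (∈-subsets p)

subsets⁺ : ∀ n → Unique (subsets n)
subsets⁺ zero    = All.[] ∷ []
subsets⁺ (suc n) = mapJoin⁺ (inside ∷_) (outside ∷_) Vec.∷-injectiveʳ Vec.∷-injectiveʳ (λ ())
                            (subsets⁺ n) (subsets⁺ n)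

length-subsets : ∀ n → length (subsets n) ≡ 2 ^ n
length-subsets zero    = refl
length-subsets (suc n) = begin
  length (mapJoin (inside ∷_) (outside ∷_) (subsets n) (subsets n))
    ≡⟨ length-mapJoin (inside ∷_) (outside ∷_) (subsets n) (subsets n) ⟩
  length (subsets n) + length (subsets n)
    ≡⟨ cong₂ _+_ (length-subsets n) (trans (length-subsets n) (sym (+-identityʳ (2 ^ n)))) ⟩
  2 ^ suc n
    ∎
  where open ≡-Reasoning

⊈⇒∃∈∉ : ∀ {n} {p q : Subset n} → ¬ p ⊆ₛ q → ∃[ i ] (i ∈ₛ p × i ∉ₛ q)
⊈⇒∃∈∉ {p = p} {q} p⊈q with Fin.any? (λ i → i ∈ₛ? p ×-dec ¬? (i ∈ₛ? q))
... | yes witness = witness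
... | no ∄ = contradiction (λ {i} i∈p → decidable-stable (i ∈ₛ? q) (λ i∉q → ∄ (i , i∈p , i∉q))) p⊈q

≢⇒∃∈∉ : ∀ {n} {p q : Subset n} → p ≢ q → ∃[ i ] (i ∈ₛ p × i ∉ₛ q) ⊎ ∃[ i ] (i ∉ₛ p × i ∈ₛ q)
≢⇒∃∈∉ {p = p} {q} p≢q with p ⊆? q | q ⊆? p
... | no p⊈q | _        = inj₁ (⊈⇒∃∈∉ p⊈q)
... | yes _  | no q⊈p   = let i , i∈q , i∉p = ⊈⇒∃∈∉ q⊈p in inj₂ (i , i∉p , i∈q)
... | yes p⊆q | yes q⊆p = contradiction (⊆-antisym p⊆q q⊆p) p≢q

∅≢⊤ : ∀ {n} → 0 < n → ∅ {n} ≢ ⊤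
∅≢⊤ (s≤s _) ()

≢⊤⇒∃∉ : ∀ {n} {p : Subset n} → p ≢ ⊤ → ∃[ i ] i ∉ₛ p
≢⊤⇒∃∉ p≢⊤ = let i , _ , i∉p = ⊈⇒∃∈∉ (p≢⊤ ∘ ⊆-antisym ⊆⊤) in i , i∉p

m+2^m≤n+2^n⇒m≤n : ∀ {m n} → m + 2 ^ m ≤ n + 2 ^ n → m ≤ n
m+2^m≤n+2^n⇒m≤n le = ≮⇒≥ λ n<m → <⇒≱ (+-mono-<-≤ n<m (^-monoʳ-≤ 2 (<⇒≤ n<m))) le

module _ {G : Graph} where

  walk₀⇒≡ : ∀ {u v} → Walk G u v 0 → u ≡ v
  walk₀⇒≡ nil = refl

  walk₁⇒Adj : ∀ {u v} → Walk G u v 1 → Adj G u v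
  walk₁⇒Adj (cons u~v nil) = u~v

  Dist-functional : ∀ {u v a b} → Dist G u v a → Dist G u v b → a ≡ b
  Dist-functional (walkᵃ , minᵃ) (walkᵇ , minᵇ) = ≤-antisym (minᵃ _ walkᵇ) (minᵇ _ walkᵃ)

module Distance (G : Graph) (dist : V G → V G → ℕ) (Dist-dist : ∀ u v → Dist G u v (dist u v)) where

  dist-refl : ∀ u → dist u u ≡ 0
  dist-refl u = Dist-functional (Dist-dist u u) (nil , λ _ _ → z≤n)

  dist-pos : ∀ {u v} → u ≢ v → 0 < dist u v
  dist-pos {u} {v} u≢v = n≢0⇒n>0 λ d≡0 → u≢v (walk₀⇒≡ (subst (Walk G u v) d≡0 (proj₁ (Dist-dist u v))))

  edist : Edge G → V G → ℕ
  edist ((x , y) , _) s = dist x s ⊓ dist y s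

  EdgeDist-edist : ∀ e s → EdgeDist G e s (edist e s)
  EdgeDist-edist ((x , y) , _) s = dist x s , dist y s , Dist-dist x s , Dist-dist y s , refl

  EdgeDist-functional : ∀ e {s a} → EdgeDist G e s a → a ≡ edist e s
  EdgeDist-functional ((x , y) , _) {s} (_ , _ , dˣ , dʸ , a≡) =
    trans a≡ (cong₂ _⊓_ (Dist-functional dˣ (Dist-dist x s)) (Dist-functional dʸ (Dist-dist y s)))

  edist-flip : ∀ {x y} (p : Adj G x y) (q : Adj G y x) s → edist ((y , x) , q) s ≡ edist ((x , y) , p) s
  edist-flip {x} {y} _ _ s = ⊓-comm (dist y s) (dist x s)

  edist-endpoint : ∀ {x y s} (p : Adj G x y) → s ≡ x ⊎ s ≡ y → edist ((x , y) , p) s ≡ 0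
  edist-endpoint {x} {y} _ (inj₁ refl) = cong (_⊓ dist y x) (dist-refl x)
  edist-endpoint {x} {y} _ (inj₂ refl) = trans (cong (dist x y ⊓_) (dist-refl y)) (⊓-zeroʳ (dist x y))

  edist-pos : ∀ {x y s} (p : Adj G x y) → s ≢ x → s ≢ y → 0 < edist ((x , y) , p) s
  edist-pos _ s≢x s≢y = ⊓-glb (dist-pos (s≢x ∘ sym)) (dist-pos (s≢y ∘ sym))

  data Resolves (S : List (V G)) (x y : V G) : Set where
    resolved-by : ∀ {s} → s ∈ S → dist x s ≢ dist y s → Resolves S x y

  data EdgeResolves (S : List (V G)) (e f : Edge G) : Set where
    resolved-by : ∀ {s} → s ∈ S → edist e s ≢ edist f s → EdgeResolves S e f

  module _ {S : List (V G)} where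

    resolving⁺ : (∀ x y → x ≢ y → Resolves S x y) → Resolving G S
    resolving⁺ resolves x y x≢y with resolves x y x≢y
    ... | resolved-by {s} s∈S dˣ≢dʸ =
      s , s∈S , dist x s , dist y s , Dist-dist x s , Dist-dist y s , dˣ≢dʸ

    resolving⁻ : Resolving G S → ∀ {x y} → x ≢ y → Resolves S x y
    resolving⁻ S-resolving {x} {y} x≢y =
      let s , s∈S , a , b , dᵃ , dᵇ , a≢b = S-resolving x y x≢y
      in resolved-by s∈S λ eq → a≢b (trans (Dist-functional dᵃ (Dist-dist x s))
                                    (trans eq (Dist-functional (Dist-dist y s) dᵇ)))

    edgeResolving⁺ : (∀ e f → ¬ SameEdge G e f → EdgeResolves S e f) → EdgeResolving G S
    edgeResolving⁺ resolves e f e≠f with resolves e f e≠f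
    ... | resolved-by {s} s∈S eᵈ≢fᵈ =
      s , s∈S , edist e s , edist f s , EdgeDist-edist e s , EdgeDist-edist f s , eᵈ≢fᵈ

    edgeResolving⁻ : EdgeResolving G S → ∀ e f → ¬ SameEdge G e f → EdgeResolves S e f
    edgeResolving⁻ S-resolving e f e≠f =
      let s , s∈S , a , b , dᵃ , dᵇ , a≢b = S-resolving e f e≠f
      in resolved-by s∈S λ eq → a≢b (trans (EdgeDist-functional e dᵃ)
                                    (trans eq (sym (EdgeDist-functional f dᵇ))))

    Resolves-sym : ∀ {x y} → Resolves S x y → Resolves S y x
    Resolves-sym (resolved-by s∈S ≢) = resolved-by s∈S (≢ ∘ sym)

    EdgeResolves-sym : ∀ {e f} → EdgeResolves S e f → EdgeResolves S f e
    EdgeResolves-sym (resolved-by s∈S ≢) = resolved-by s∈S (≢ ∘ sym)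

    EdgeResolves-flipˡ : ∀ {x y f} (p : Adj G x y) (q : Adj G y x) →
                         EdgeResolves S ((y , x) , q) f → EdgeResolves S ((x , y) , p) f
    EdgeResolves-flipˡ p q (resolved-by s∈S ≢) = resolved-by s∈S (≢ ∘ trans (edist-flip p q _))

    EdgeResolves-flipʳ : ∀ {e x y} (p : Adj G x y) (q : Adj G y x) →
                         EdgeResolves S e ((y , x) , q) → EdgeResolves S e ((x , y) , p)
    EdgeResolves-flipʳ p q (resolved-by s∈S ≢) = resolved-by s∈S λ eq → ≢ (trans eq (sym (edist-flip p q _)))

    member-resolves : ∀ {x y} → x ∈ S → x ≢ y → Resolves S x y
    member-resolves {x} x∈S x≢y =
      resolved-by x∈S λ eq → <⇒≢ (dist-pos (x≢y ∘ sym)) (trans (sym (dist-refl x)) eq)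

    endpoint-resolves : ∀ {x y x′ y′ s} (p : Adj G x y) (q : Adj G x′ y′) → s ∈ S →
                        s ≡ x ⊎ s ≡ y → s ≢ x′ → s ≢ y′ → EdgeResolves S ((x , y) , p) ((x′ , y′) , q)
    endpoint-resolves p q s∈S s-endpoint s≢x′ s≢y′ =
      resolved-by s∈S λ eq → <⇒≢ (edist-pos q s≢x′ s≢y′) (trans (sym (edist-endpoint p s-endpoint)) eq)

module UniversalVertex
  (G : Graph) (_≟_ : DecidableEquality (V G)) (adj? : Decidable (Adj G))
  (Adj-irrefl : Irreflexive _≡_ (Adj G)) (Adj-sym : Symmetric (Adj G))
  (c : V G) (universal : ∀ {v} → v ≢ c → Adj G c v)
  where

  open DecMembership _≟_ using (_∈?_)

  distinctDist : Bool → ℕ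
  distinctDist true  = 1
  distinctDist false = 2

  dist : V G → V G → ℕ
  dist u v = if does (u ≟ v) then 0 else distinctDist (does (adj? u v))

  dist-≢ : ∀ {u v} → u ≢ v → dist u v ≡ distinctDist (does (adj? u v))
  dist-≢ {u} {v} u≢v with u ≟ v
  ... | yes u≡v = contradiction u≡v u≢v
  ... | no _    = refl

  nonadjacent⇒≢c : ∀ {u v} → u ≢ v → ¬ Adj G u v → u ≢ c
  nonadjacent⇒≢c u≢v u≁v refl = u≁v (universal (u≢v ∘ sym))

  Dist-dist : ∀ u v → Dist G u v (dist u v)
  Dist-dist u v with u ≟ v
  ... | yes refl = nil , λ _ _ → z≤n
  ... | no u≢v with adj? u v
  ...   | yes u~v = cons u~v nil , λ where
            zero w    → contradiction (walk₀⇒≡ w) u≢v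
            (suc _) _ → s≤s z≤n
  ...   | no u≁v = path-through-c , λ where
            zero w          → contradiction (walk₀⇒≡ w) u≢v
            (suc zero) w    → contradiction (walk₁⇒Adj w) u≁v
            (suc (suc _)) _ → s≤s (s≤s z≤n)
    where
    path-through-c : Walk G u v 2
    path-through-c = cons (Adj-sym (universal (nonadjacent⇒≢c u≢v u≁v)))
                          (cons (universal (nonadjacent⇒≢c (u≢v ∘ sym) (u≁v ∘ Adj-sym))) nil)

  open Distance G dist Dist-dist public

  dist-adj : ∀ {u v} → Adj G u v → dist u v ≡ 1
  dist-adj {u} {v} u~v rewrite dist-≢ (λ u≡v → Adj-irrefl u≡v u~v) | dec-true (adj? u v) u~v = refl

  dist-nonadj : ∀ {u v} → u ≢ v → ¬ Adj G u v → dist u v ≡ 2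
  dist-nonadj {u} {v} u≢v u≁v rewrite dist-≢ u≢v | dec-false (adj? u v) u≁v = refl

  dist-c≤1 : ∀ s → dist c s ≤ 1
  dist-c≤1 s with s ≟ c
  ... | yes refl = subst (_≤ 1) (sym (dist-refl c)) z≤n
  ... | no s≢c   = subst (_≤ 1) (sym (dist-adj (universal s≢c))) (s≤s z≤n)

  spoke : ∀ {x} → x ≢ c → Edge G
  spoke {x} x≢c = (c , x) , universal x≢c

  edist-spoke : ∀ {x s} (x≢c : x ≢ c) → x ≢ s → edist (spoke x≢c) s ≡ dist c s
  edist-spoke {x} {s} _ x≢s = m≤n⇒m⊓n≡m (≤-trans (dist-c≤1 s) (dist-pos x≢s))

  spokes-differ : ∀ {x y} (x≢c : x ≢ c) (y≢c : y ≢ c) → x ≢ y → ¬ SameEdge G (spoke x≢c) (spoke y≢c)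
  spokes-differ _   _ x≢y (inj₁ (_ , x≡y)) = x≢y x≡y
  spokes-differ x≢c _ _   (inj₂ (_ , x≡c)) = x≢c x≡c

  edist-spokes-agree : ∀ {S x y s} (x≢c : x ≢ c) (y≢c : y ≢ c) → x ∉ S → y ∉ S → s ∈ S →
                       edist (spoke x≢c) s ≡ edist (spoke y≢c) s
  edist-spokes-agree x≢c y≢c x∉S y∉S s∈S =
    trans (edist-spoke x≢c (∉⇒≢ x∉S s∈S)) (sym (edist-spoke y≢c (∉⇒≢ y∉S s∈S)))

  module _ (S : List (V G)) where

    adjacencyPattern : V G → Subset (length S)
    adjacencyPattern v = tabulate (λ i → does (adj? v (lookup S i)))

    lookup-adjacencyPattern : ∀ v {s} (s∈S : s ∈ S) →
                              lookupᵥ (adjacencyPattern v) (Any.index s∈S) ≡ does (adj? v s)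
    lookup-adjacencyPattern v s∈S =
      trans (lookup∘tabulate _ (Any.index s∈S)) (cong (does ∘ adj? v) (sym (lookup-index s∈S)))

    -- Outside S, distances to S are 1 or 2, so the adjacency pattern determines them.
    encode : V G → V G ⊎ Subset (length S)
    encode v = if does (v ∈? S) then inj₁ v else inj₂ (adjacencyPattern v)

    same-pattern⇒same-dist : ∀ {x y s} → x ∉ S → y ∉ S →
                             adjacencyPattern x ≡ adjacencyPattern y → s ∈ S → dist x s ≡ dist y s
    same-pattern⇒same-dist {x} {y} {s} x∉S y∉S same s∈S = begin
      dist x s                         ≡⟨ dist-≢ (∉⇒≢ x∉S s∈S) ⟩
      distinctDist (does (adj? x s))   ≡⟨ cong distinctDist same-adjacency ⟩
      distinctDist (does (adj? y s))   ≡⟨ dist-≢ (∉⇒≢ y∉S s∈S) ⟨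
      dist y s                         ∎
      where
      open ≡-Reasoning
      same-adjacency : does (adj? x s) ≡ does (adj? y s)
      same-adjacency = begin
        does (adj? x s)                                  ≡⟨ sym (lookup-adjacencyPattern x s∈S) ⟩
        lookupᵥ (adjacencyPattern x) (Any.index s∈S)     ≡⟨ cong (λ p → lookupᵥ p (Any.index s∈S)) same ⟩
        lookupᵥ (adjacencyPattern y) (Any.index s∈S)     ≡⟨ lookup-adjacencyPattern y s∈S ⟩
        does (adj? y s)                                  ∎

    encode-injective : Resolving G S → ∀ {x y} → encode x ≡ encode y → x ≡ y
    encode-injective S-resolving {x} {y} eq with x ∈? S | y ∈? S
    encode-injective _ eq | yes _  | yes _  = inj₁-injective eq
    encode-injective _ () | yes _  | no _
    encode-injective _ () | no _   | yes _
    encode-injective S-resolving {x} {y} eq | no x∉S | no y∉S with x ≟ y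
    ... | yes x≡y = x≡y
    ... | no x≢y with resolving⁻ S-resolving x≢y
    ...   | resolved-by s∈S dˣ≢dʸ =
      contradiction (same-pattern⇒same-dist x∉S y∉S (inj₂-injective eq) s∈S) dˣ≢dʸ

    encode-∈ : ∀ v → encode v ∈ mapJoin inj₁ inj₂ S (subsets (length S))
    encode-∈ v with v ∈? S
    ... | yes v∈S = ∈-mapJoinˡ inj₁ inj₂ _ v∈S
    ... | no _    = ∈-mapJoinʳ inj₁ inj₂ S (∈-subsets _)

  resolving⇒length≤ : ∀ {vs S} → Unique vs → Resolving G S → length vs ≤ length S + 2 ^ length S
  resolving⇒length≤ {vs} {S} vs! S-resolving = begin
    length vs                                          ≡⟨ length-map (encode S) vs ⟨
    length (map (encode S) vs)                         ≤⟨ Unique-⊆⇒length≤ encodings! encodings⊆ ⟩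
    length (mapJoin inj₁ inj₂ S (subsets (length S)))  ≡⟨ length-mapJoin inj₁ inj₂ S (subsets (length S)) ⟩
    length S + length (subsets (length S))             ≡⟨ cong (length S +_) (length-subsets (length S)) ⟩
    length S + 2 ^ length S                            ∎
    where
    open ≤-Reasoning
    encodings! : Unique (map (encode S) vs)
    encodings! = Unique.map⁺ (encode-injective S S-resolving) vs!
    encodings⊆ : map (encode S) vs ⊆ mapJoin inj₁ inj₂ S (subsets (length S))
    encodings⊆ z∈ with ∈-map⁻ (encode S) z∈
    ... | v , _ , refl = encode-∈ S v

  edgeResolving⇒length≤ : ∀ {vs S} → Unique vs → EdgeResolving G S → length vs ≤ 2 + length S
  edgeResolving⇒length≤ {vs} {S} vs! S-resolving = one-outside⇒length≤ _≟_ vs! spokes-unresolved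
    where
    spokes-unresolved : ∀ {x y} → x ∈ vs → y ∈ vs → x ∉ c ∷ S → y ∉ c ∷ S → x ≡ y
    spokes-unresolved {x} {y} _ _ x∉ y∉ with x ≟ y
    ... | yes x≡y = x≡y
    ... | no x≢y with edgeResolving⁻ S-resolving (spoke (x∉ ∘ here)) (spoke (y∉ ∘ here))
                        (spokes-differ (x∉ ∘ here) (y∉ ∘ here) x≢y)
    ...   | resolved-by s∈S dˣ≢dʸ =
      contradiction (edist-spokes-agree (x∉ ∘ here) (y∉ ∘ here) (x∉ ∘ there) (y∉ ∘ there) s∈S) dˣ≢dʸ

module Fₖ (k : ℕ) where

  _≟_ : DecidableEquality (V (F k))
  _≟_ = Sum.≡-dec Fin._≟_ (Vec.≡-dec Bool._≟_)

  adj? : Decidable (FAdj k)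
  adj? (inj₁ i) (inj₁ j) = ¬? (i Fin.≟ j)
  adj? (inj₂ p) (inj₂ q) = ¬? (Vec.≡-dec Bool._≟_ p q)
  adj? (inj₁ i) (inj₂ p) = i ∈ₛ? p
  adj? (inj₂ p) (inj₁ i) = i ∈ₛ? p

  FAdj-irrefl : Irreflexive _≡_ (FAdj k)
  FAdj-irrefl {inj₁ _} refl i≢i = i≢i refl
  FAdj-irrefl {inj₂ _} refl p≢p = p≢p refl

  FAdj-sym : Symmetric (FAdj k)
  FAdj-sym {inj₁ _} {inj₁ _} i≢j = i≢j ∘ sym
  FAdj-sym {inj₂ _} {inj₂ _} p≢q = p≢q ∘ sym
  FAdj-sym {inj₁ _} {inj₂ _} i∈p = i∈p
  FAdj-sym {inj₂ _} {inj₁ _} i∈p = i∈p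

  FAdj⇒≢ : ∀ {x y} → FAdj k x y → x ≢ y
  FAdj⇒≢ x~y x≡y = FAdj-irrefl x≡y x~y

  full-universal : ∀ {v} → v ≢ inj₂ ⊤ → FAdj k (inj₂ ⊤) v
  full-universal {inj₁ _} _   = ∈⊤
  full-universal {inj₂ _} v≢⊤ = v≢⊤ ∘ cong inj₂ ∘ sym

  open UniversalVertex (F k) _≟_ adj? FAdj-irrefl FAdj-sym (inj₂ ⊤) full-universal

  vertices : List (V (F k))
  vertices = mapJoin inj₁ inj₂ (allFin k) (subsets k)

  vertices-unique : Unique vertices
  vertices-unique =
    mapJoin⁺ inj₁ inj₂ inj₁-injective inj₂-injective (λ ()) (Unique.allFin⁺ k) (subsets⁺ k)

  ∈-vertices : ∀ v → v ∈ vertices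
  ∈-vertices (inj₁ i) = ∈-mapJoinˡ inj₁ inj₂ (subsets k) (∈-allFin i)
  ∈-vertices (inj₂ p) = ∈-mapJoinʳ inj₁ inj₂ (allFin k) (∈-subsets p)

  length-vertices : length vertices ≡ k + 2 ^ k
  length-vertices = trans (length-mapJoin inj₁ inj₂ (allFin k) (subsets k))
                          (cong₂ _+_ (length-tabulate (λ i → i)) (length-subsets k))

  B : List (V (F k))
  B = map inj₁ (allFin k)

  B-unique : Unique B
  B-unique = Unique.map⁺ inj₁-injective (Unique.allFin⁺ k)

  ∈-B : ∀ i → inj₁ i ∈ B
  ∈-B i = ∈-map⁺ inj₁ (∈-allFin i)

  length-B : length B ≡ k
  length-B = trans (length-map inj₁ (allFin k)) (length-tabulate (λ i → i))

  element-resolves : ∀ {i p q} → i ∈ₛ p → i ∉ₛ q → Resolves B (inj₂ p) (inj₂ q)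
  element-resolves {i} {p} {q} i∈p i∉q = resolved-by (∈-B i) λ eq →
    contradiction (trans (sym (dist-adj {inj₂ p} {inj₁ i} i∈p))
                         (trans eq (dist-nonadj {inj₂ q} {inj₁ i} (λ ()) i∉q))) λ ()

  B-resolving : Resolving (F k) B
  B-resolving = resolving⁺ resolves
    where
    resolves : ∀ x y → x ≢ y → Resolves B x y
    resolves (inj₁ i) _        x≢y = member-resolves (∈-B i) x≢y
    resolves (inj₂ _) (inj₁ j) x≢y = Resolves-sym (member-resolves (∈-B j) (x≢y ∘ sym))
    resolves (inj₂ _) (inj₂ _) x≢y with ≢⇒∃∈∉ (x≢y ∘ cong inj₂)
    ... | inj₁ (_ , i∈p , i∉q) = element-resolves i∈p i∉q
    ... | inj₂ (_ , i∉p , i∈q) = Resolves-sym (element-resolves i∈q i∉p)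

  resolving⇒k≤length : ∀ {S} → Resolving (F k) S → k ≤ length S
  resolving⇒k≤length {S} S-resolving = m+2^m≤n+2^n⇒m≤n (begin
    k + 2 ^ k                ≡⟨ length-vertices ⟨
    length vertices          ≤⟨ resolving⇒length≤ {S = S} vertices-unique S-resolving ⟩
    length S + 2 ^ length S  ∎)
    where open ≤-Reasoning

  data Extreme : V (F k) → Set where
    empty : Extreme (inj₂ ∅)
    full  : Extreme (inj₂ ⊤)

  extreme? : ∀ v → Dec (Extreme v)
  extreme? (inj₁ _) = no λ ()
  extreme? (inj₂ p) with Vec.≡-dec Bool._≟_ p ∅ | Vec.≡-dec Bool._≟_ p ⊤
  ... | yes refl | _        = yes empty
  ... | no _     | yes refl = yes full
  ... | no p≢∅   | no p≢⊤   = no λ { empty → p≢∅ refl ; full → p≢⊤ refl }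

  third-extreme : ∀ {x y z} → Extreme x → Extreme y → Extreme z → x ≢ y → x ≢ z → y ≡ z
  third-extreme empty full  full  _   _   = refl
  third-extreme full  empty empty _   _   = refl
  third-extreme empty empty _     x≢y _   = contradiction refl x≢y
  third-extreme full  full  _     x≢y _   = contradiction refl x≢y
  third-extreme empty full  empty _   x≢z = contradiction refl x≢z
  third-extreme full  empty full  _   x≢z = contradiction refl x≢z

  interior : List (V (F k))
  interior = filter (¬? ∘ extreme?) vertices

  interior-unique : Unique interior
  interior-unique = Unique.filter⁺ (¬? ∘ extreme?) vertices-unique

  ∈-interior : ∀ {v} → ¬ Extreme v → v ∈ interior
  ∈-interior {v} v-interior = ∈-filter⁺ (¬? ∘ extreme?) (∈-vertices v) v-interior

  interior⇒¬Extreme : ∀ {v} → v ∈ interior → ¬ Extreme v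
  interior⇒¬Extreme v∈ = proj₂ (∈-filter⁻ (¬? ∘ extreme?) {xs = vertices} v∈)

  empty-full-resolved : ∀ {x} (p : FAdj k x (inj₂ ∅)) (q : FAdj k x (inj₂ ⊤)) →
                        EdgeResolves interior ((x , inj₂ ∅) , p) ((x , inj₂ ⊤) , q)
  empty-full-resolved {inj₁ _} i∈∅ _ = contradiction i∈∅ ∉⊥
  empty-full-resolved {inj₂ r} p r≢⊤ = resolved-by-outsider (≢⊤⇒∃∉ r≢⊤)
    where
    resolved-by-outsider : ∃[ i ] i ∉ₛ r →
                           EdgeResolves interior ((inj₂ r , inj₂ ∅) , p) ((inj₂ r , inj₂ ⊤) , r≢⊤)
    resolved-by-outsider (i , i∉r) = resolved-by (∈-interior {inj₁ i} λ ()) λ eq →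
      contradiction (begin
        2                                         ≡⟨ cong₂ _⊓_ r-to-i ∅-to-i ⟨
        edist ((inj₂ r , inj₂ ∅) , p) (inj₁ i)    ≡⟨ eq ⟩
        edist ((inj₂ r , inj₂ ⊤) , r≢⊤) (inj₁ i)  ≡⟨ cong₂ _⊓_ r-to-i ⊤-to-i ⟩
        1                                         ∎) λ ()
      where
      open ≡-Reasoning
      r-to-i : dist (inj₂ r) (inj₁ i) ≡ 2
      r-to-i = dist-nonadj {inj₂ r} {inj₁ i} (λ ()) i∉r
      ∅-to-i : dist (inj₂ ∅) (inj₁ i) ≡ 2
      ∅-to-i = dist-nonadj {inj₂ ∅} {inj₁ i} (λ ()) ∉⊥
      ⊤-to-i : dist (inj₂ ⊤) (inj₁ i) ≡ 1
      ⊤-to-i = dist-adj {inj₂ ⊤} {inj₁ i} ∈⊤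

  common-endpoint : ∀ {x y z} (p : FAdj k x y) (q : FAdj k x z) → y ≢ z →
                    EdgeResolves interior ((x , y) , p) ((x , z) , q)
  common-endpoint {x} {y} {z} p q y≢z with extreme? y | extreme? z
  ... | no y-interior | _ =
    endpoint-resolves p q (∈-interior y-interior) (inj₂ refl) (FAdj⇒≢ p ∘ sym) y≢z
  ... | yes _ | no z-interior = EdgeResolves-sym
    (endpoint-resolves q p (∈-interior z-interior) (inj₂ refl) (FAdj⇒≢ q ∘ sym) (y≢z ∘ sym))
  ... | yes empty | yes full  = empty-full-resolved p q
  ... | yes full  | yes empty = EdgeResolves-sym (empty-full-resolved q p)
  ... | yes empty | yes empty = contradiction refl y≢z
  ... | yes full  | yes full  = contradiction refl y≢z

  disjoint-edges : ∀ {x y x′ y′} (p : FAdj k x y) (q : FAdj k x′ y′) →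
                   x ≢ x′ → x ≢ y′ → y ≢ x′ → y ≢ y′ →
                   EdgeResolves interior ((x , y) , p) ((x′ , y′) , q)
  disjoint-edges {x} {y} {x′} p q x≢x′ x≢y′ y≢x′ y≢y′
    with extreme? x | extreme? y | extreme? x′
  ... | no x-interior | _ | _ =
    endpoint-resolves p q (∈-interior x-interior) (inj₁ refl) x≢x′ x≢y′
  ... | yes _ | no y-interior | _ =
    endpoint-resolves p q (∈-interior y-interior) (inj₂ refl) y≢x′ y≢y′
  ... | yes _ | yes _ | no x′-interior = EdgeResolves-sym
    (endpoint-resolves q p (∈-interior x′-interior) (inj₁ refl) (x≢x′ ∘ sym) (y≢x′ ∘ sym))
  ... | yes ex | yes ey | yes ex′ = contradiction (third-extreme ex ey ex′ (FAdj⇒≢ p) x≢x′) y≢x′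

  interior-resolves : ∀ e f → ¬ SameEdge (F k) e f → EdgeResolves interior e f
  interior-resolves ((x , y) , p) ((x′ , y′) , q) e≠f with x ≟ x′ | x ≟ y′ | y ≟ x′ | y ≟ y′
  ... | yes refl | _        | _        | yes refl = contradiction (inj₁ (refl , refl)) e≠f
  ... | yes refl | _        | _        | no y≢y′  = common-endpoint p q y≢y′
  ... | no _     | yes refl | yes refl | _        = contradiction (inj₂ (refl , refl)) e≠f
  ... | no _     | yes refl | no y≢x′  | _        =
    EdgeResolves-flipʳ q (FAdj-sym q) (common-endpoint p (FAdj-sym q) y≢x′)
  ... | no _     | no x≢y′  | yes refl | _        =
    EdgeResolves-flipˡ p (FAdj-sym p) (common-endpoint (FAdj-sym p) q x≢y′)
  ... | no x≢x′  | no _     | no _     | yes refl =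
    EdgeResolves-flipˡ p (FAdj-sym p) (EdgeResolves-flipʳ q (FAdj-sym q)
      (common-endpoint (FAdj-sym p) (FAdj-sym q) x≢x′))
  ... | no x≢x′  | no x≢y′  | no y≢x′  | no y≢y′  = disjoint-edges p q x≢x′ x≢y′ y≢x′ y≢y′

  interior-edgeResolving : EdgeResolving (F k) interior
  interior-edgeResolving = edgeResolving⁺ interior-resolves

  edgeResolving⇒k+2^k∸2≤length : ∀ {S} → EdgeResolving (F k) S → k + 2 ^ k ∸ 2 ≤ length S
  edgeResolving⇒k+2^k∸2≤length {S} S-resolving = m≤n+o⇒m∸n≤o (k + 2 ^ k) 2 (begin
    k + 2 ^ k        ≡⟨ length-vertices ⟨
    length vertices  ≤⟨ edgeResolving⇒length≤ vertices-unique S-resolving ⟩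
    2 + length S     ∎)
    where open ≤-Reasoning

  length-interior : 0 < k → length interior ≡ k + 2 ^ k ∸ 2
  length-interior 0<k =
    ≤-antisym (m+n≤o⇒m≤o∸n (length interior) interior+2≤)
              (edgeResolving⇒k+2^k∸2≤length interior-edgeResolving)
    where
    extremes∉interior : ∀ {x} → Extreme x → All.All (x ≢_) interior
    extremes∉interior ex = All.tabulate λ v∈ x≡v → interior⇒¬Extreme v∈ (subst Extreme x≡v ex)

    extremes∷interior-unique : Unique (inj₂ ∅ ∷ inj₂ ⊤ ∷ interior)
    extremes∷interior-unique =
      ((∅≢⊤ 0<k ∘ inj₂-injective) All.∷ extremes∉interior empty)
        ∷ extremes∉interior full ∷ interior-unique

    interior+2≤ : length interior + 2 ≤ k + 2 ^ k
    interior+2≤ = subst₂ _≤_ (+-comm 2 (length interior)) length-vertices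
                    (Unique-⊆⇒length≤ extremes∷interior-unique (λ {v} _ → ∈-vertices v))

theorem3p7 : ∀ (k : ℕ) → 1 ≤ k →
    MetricDim (F k) k × EdgeMetricDim (F k) (k + 2 ^ k ∸ 2)
theorem3p7 k 0<k =
  ((B , B-unique , B-resolving , length-B) , λ _ _ → resolving⇒k≤length) ,
  ((interior , interior-unique , interior-edgeResolving , length-interior 0<k) ,
   λ _ _ → edgeResolving⇒k+2^k∸2≤length)
  where open Fₖ k
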